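{- Let $G$ be a finite simple graph and let $D\subseteq V(G)$ be a set of vertices each of which has at least $2$ neighbours in $\overline{D}:=V(G)\setminus D$. Let $H$ be the bipartite graph obtained from $G$ by deleting all edges with both endpoints in $D$ and all edges with both endpoints in $\overline{D}$. Then $\Delta(G)\ge\prod_{v\in D}(d_H(v)-1)$.
   Context: For a finite simple graph $G$, the elements of $G$ are its vertices and edges. Two elements $\alpha,\beta\in V(G)\cup E(G)$ are incident if $\alpha=\beta$, or one is an edge and the other is an endpoint of that edge. $M(G)$ is the $0/1$ matrix with rows and columns indexed by $V(G)\cup E(G)$ whose $(\alpha,\beta)$ entry is $1$ iff $\alpha$ and $\beta$ are incident; equivalently $M(G)=\begin{bmatrix} I & B\\ B^\intercal & I\end{bmatrix}$ where $B$ is the vertex-edge incidence matrix of $G$. $\Delta(G)$ denotes the maximum of $|\det M'|$ over all square submatrices $M'$ of $M(G)$. $d_H(v)$ is the degree of $v$ in $H$. -}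

module Defs where

open import Data.Nat as ℕ using (ℕ; zero; suc; _∸_)
open import Data.Integer as ℤ using (ℤ; +_; -_)
open import Data.Fin using (Fin; zero; suc; punchIn; _≟_; splitAt)
import Data.Fin as F
open import Data.Bool using (Bool; true; false; _∧_; _xor_; if_then_else_; not)
open import Data.Product using (_×_; _,_; proj₁; proj₂; Σ; ∃)
open import Data.Sum using (_⊎_; inj₁; inj₂)
open import Relation.Binary.PropositionalEquality using (_≡_; _≢_)
open import Relation.Nullary.Decidable using (⌊_⌋)

record Graph (n m : ℕ) : Set where
  field
    ends      : Fin m → Fin n × Fin n
    loopless  : ∀ k → proj₁ (ends k) ≢ proj₂ (ends k)
    noMulti   : ∀ k l →
                ((proj₁ (ends k) ≡ proj₁ (ends l)) × (proj₂ (ends k) ≡ proj₂ (ends l)))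
                ⊎ ((proj₁ (ends k) ≡ proj₂ (ends l)) × (proj₂ (ends k) ≡ proj₁ (ends l)))
                → k ≡ l

open Graph public

Adj : ∀ {n m} → Graph n m → Fin n → Fin n → Set
Adj G u v = ∃ λ k → ((proj₁ (ends G k) ≡ u) × (proj₂ (ends G k) ≡ v))
                  ⊎ ((proj₁ (ends G k) ≡ v) × (proj₂ (ends G k) ≡ u))

incidentB : ∀ {n m} → Graph n m → Fin n → Fin m → Bool
incidentB G v k with ⌊ proj₁ (ends G k) ≟ v ⌋ | ⌊ proj₂ (ends G k) ≟ v ⌋
... | false | false = false
... | _     | _     = true

-- Incidence matrix M(G) = [[I, B], [Bᵀ, I]], indexed by Fin (n + m):
-- the first n indices are the vertices, the last m the edges.

Matrix : ℕ → ℕ → Set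
Matrix r c = Fin r → Fin c → ℤ

b2z : Bool → ℤ
b2z true  = + 1
b2z false = + 0

incMatrix : ∀ {n m} → Graph n m → Matrix (n ℕ.+ m) (n ℕ.+ m)
incMatrix {n} {m} G i j with splitAt n i | splitAt n j
... | inj₁ u | inj₁ v = b2z ⌊ u ≟ v ⌋
... | inj₂ k | inj₂ l = b2z ⌊ k ≟ l ⌋
... | inj₁ u | inj₂ l = b2z (incidentB G u l)
... | inj₂ k | inj₁ v = b2z (incidentB G v k)

sumFin : ∀ {k} → (Fin k → ℤ) → ℤ
sumFin {zero}  f = + 0
sumFin {suc k} f = f zero ℤ.+ sumFin (λ i → f (suc i))

sign : ℕ → ℤ
sign zero          = + 1
sign (suc zero)    = - (+ 1)
sign (suc (suc j)) = sign j

det : ∀ {k} → Matrix k k → ℤ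
det {zero}  A = + 1
det {suc k} A = sumFin λ j →
  sign (F.toℕ j) ℤ.* A zero j ℤ.* det (λ r c → A (suc r) (punchIn j c))

StrictlyIncreasing : ∀ {k N} → (Fin k → Fin N) → Set
StrictlyIncreasing f = ∀ i j → i F.< j → f i F.< f j

submatrix : ∀ {k N} → Matrix N N → (Fin k → Fin N) → (Fin k → Fin N) → Matrix k k
submatrix A rs cs i j = A (rs i) (cs j)

crossingB : ∀ {n m} → Graph n m → (Fin n → Bool) → Fin m → Bool
crossingB G D k = D (proj₁ (ends G k)) xor D (proj₂ (ends G k))

countFin : ∀ {k} → (Fin k → Bool) → ℕ
countFin {zero}  p = 0
countFin {suc k} p = (if p zero then 1 else 0) ℕ.+ countFin (λ i → p (suc i))

degH : ∀ {n m} → Graph n m → (Fin n → Bool) → Fin n → ℕ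
degH G D v = countFin λ k → incidentB G v k ∧ crossingB G D k

prodD : ∀ {n} → (Fin n → Bool) → (Fin n → ℕ) → ℕ
prodD {zero}  D f = 1
prodD {suc n} D f = (if D zero then f zero else 1) ℕ.* prodD (λ i → D (suc i)) (λ i → f (suc i))

module Submission where

-- Select the rows and columns of M(G) indexed by D and by the edges of H; vertices come
-- before edges.  Subtracting from each vertex row v the rows of the H-edges at v is a
-- unimodular row operation (only later rows are added), and it clears the edge columns of
-- the vertex rows.  Since no edge of H has both ends in D, the vertex block becomes
-- diagonal with entries 1 - d_H(v): the matrix is now lower triangular, so its determinant
-- is the product of the 1 - d_H(v), v ∈ D, whose absolute value bounds the product of the
-- d_H(v) - 1.  As det is the expansion along the first row, invariance under these row
-- operations comes from linearity in the first row together with the vanishing of det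
-- when the first row is repeated, which follows from the sign change under swapping the
-- first two rows.

open import Defs
open import Algebra.Bundles using (Monoid)
open import Data.Bool using (Bool; true; false; if_then_else_; _∧_)
open import Data.Bool.Properties using (if-eta)
open import Data.Fin as Fin
  using (Fin; zero; suc; toℕ; punchIn; punchOut; _≟_; _↑ˡ_; _↑ʳ_; splitAt; join)
open import Data.Fin.Properties
  using (<-irrefl; ≤∧≢⇒<; punchInᵢ≢i; punchOut-punchIn; punchOut-cong;
         splitAt-↑ˡ; splitAt-↑ʳ; join-splitAt; toℕ-↑ˡ; toℕ-↑ʳ; toℕ<n)
open import Data.Integer using (ℤ; +_; -[1+_]; -_; _-_; _*_; 0ℤ; 1ℤ; ∣_∣)
open import Data.Integer.Properties using (+-0-monoid; *-1-monoid; +-*-semiring; abs-*)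
open import Data.Nat using (ℕ; _≤_; _∸_)
import Data.Nat as ℕ
import Data.Nat.Properties as ℕ
open import Data.Product using (Σ; ∃; _×_; _,_; proj₁; proj₂)
open import Data.Sum using (_⊎_; inj₁; inj₂; [_,_]′)
open import Data.Vec.Functional using (_∷_; tail)
open import Function using (_∘_)
open import Relation.Binary.PropositionalEquality
  using (_≡_; _≢_; refl; sym; trans; cong; cong₂; subst; subst₂; _≗_; module ≡-Reasoning)
open import Relation.Nullary using (yes; no; contradiction)
open import Relation.Nullary.Decidable using (⌊_⌋; isYes≗does; dec-true; dec-false)

enumerate : ∀ {N} (p : Fin N → Bool) → Fin (countFin p) → Fin N
enumerate {ℕ.suc N} p r with p zero
enumerate {ℕ.suc N} p zero    | true  = zero
enumerate {ℕ.suc N} p (suc r) | true  = suc (enumerate (p ∘ suc) r)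
enumerate {ℕ.suc N} p r       | false = suc (enumerate (p ∘ suc) r)

enumerate-selected : ∀ {N} (p : Fin N → Bool) r → p (enumerate p r) ≡ true
enumerate-selected {ℕ.suc N} p r with p zero in p₀
enumerate-selected {ℕ.suc N} p zero    | true  = p₀
enumerate-selected {ℕ.suc N} p (suc r) | true  = enumerate-selected (p ∘ suc) r
enumerate-selected {ℕ.suc N} p r       | false = enumerate-selected (p ∘ suc) r

enumerate-strictlyIncreasing : ∀ {N} (p : Fin N → Bool) → StrictlyIncreasing (enumerate p)
enumerate-strictlyIncreasing {ℕ.suc N} p r s r<s with p zero
enumerate-strictlyIncreasing {ℕ.suc N} p zero    (suc s) _         | true  = ℕ.s≤s ℕ.z≤n
enumerate-strictlyIncreasing {ℕ.suc N} p (suc r) (suc s) (ℕ.s≤s r<s) | true  =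
  ℕ.s≤s (enumerate-strictlyIncreasing (p ∘ suc) r s r<s)
enumerate-strictlyIncreasing {ℕ.suc N} p r       s       r<s       | false =
  ℕ.s≤s (enumerate-strictlyIncreasing (p ∘ suc) r s r<s)

strictlyIncreasing⇒monotone : ∀ {k N} {f : Fin k → Fin N} → StrictlyIncreasing f →
                              ∀ {i j} → i Fin.≤ j → f i Fin.≤ f j
strictlyIncreasing⇒monotone increasing {i} {j} i≤j with i ≟ j
... | yes refl = ℕ.≤-refl
... | no i≢j  = ℕ.<⇒≤ (increasing i j (≤∧≢⇒< i≤j i≢j))

module MonoidSums {a ℓ} (M : Monoid a ℓ) where

  open Monoid M
    using (Carrier; _≈_; _∙_; ε; ∙-cong; ∙-congˡ; identityˡ; assoc)
    renaming (refl to ≈-refl; sym to ≈-sym; trans to ≈-trans)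
  open import Algebra.Properties.Monoid.Sum M public using (sum; sum-cong-≗)

  sum-ε : ∀ {k} {f : Fin k → Carrier} → (∀ i → f i ≈ ε) → sum f ≈ ε
  sum-ε {ℕ.zero}  f≈ε = ≈-refl
  sum-ε {ℕ.suc k} f≈ε = ≈-trans (∙-cong (f≈ε zero) (sum-ε (f≈ε ∘ suc))) (identityˡ ε)

  sum-enumerate : ∀ {N} (p : Fin N → Bool) (f : Fin N → Carrier) →
                  sum (f ∘ enumerate p) ≈ sum (λ i → if p i then f i else ε)
  sum-enumerate {ℕ.zero}  p f = ≈-refl
  sum-enumerate {ℕ.suc N} p f with p zero
  ... | true  = ∙-congˡ (sum-enumerate (p ∘ suc) (f ∘ suc))
  ... | false = ≈-trans (sum-enumerate (p ∘ suc) (f ∘ suc)) (≈-sym (identityˡ _))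

  sum-↑ : ∀ k {l} (f : Fin (k ℕ.+ l) → Carrier) →
          sum f ≈ sum (f ∘ (_↑ˡ l)) ∙ sum (f ∘ (k ↑ʳ_))
  sum-↑ ℕ.zero    f = ≈-sym (identityˡ (sum f))
  sum-↑ (ℕ.suc k) f = ≈-trans (∙-congˡ (sum-↑ k (f ∘ suc))) (≈-sym (assoc (f zero) _ _))

open MonoidSums *-1-monoid using ()
  renaming ( sum to product; sum-ε to product-one; sum-cong-≗ to product-cong-≗
           ; sum-enumerate to product-enumerate; sum-↑ to product-↑)

b2z-≟-refl : ∀ {k} (u : Fin k) → b2z ⌊ u ≟ u ⌋ ≡ 1ℤ
b2z-≟-refl u = cong b2z (trans (isYes≗does (u ≟ u)) (dec-true (u ≟ u) refl))

b2z-≟-≢ : ∀ {k} {u v : Fin k} → u ≢ v → b2z ⌊ u ≟ v ⌋ ≡ 0ℤ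
b2z-≟-≢ {u = u} {v} u≢v = cong b2z (trans (isYes≗does (u ≟ v)) (dec-false (u ≟ v) u≢v))

if-zero : ∀ b {x : ℤ} → x ≡ 0ℤ → (if b then x else 0ℤ) ≡ 0ℤ
if-zero true  x≡0 = x≡0
if-zero false _   = refl

module Determinant where

  open import Data.Integer using (_+_)
  open import Data.Integer.Properties
    using (*-zeroʳ; +-identityˡ; +-identityʳ; *-identityˡ; -1*i≡-i; neg-involutive)
  open import Data.Integer.Tactic.RingSolver using (solve-∀)
  open import Algebra.Properties.Semiring.Sum +-*-semiring
  open MonoidSums +-0-monoid using () renaming (sum-ε to sum-zero)
  open ≡-Reasoning

  sumFin≗sum : ∀ {k} (f : Fin k → ℤ) → sumFin f ≡ sum f
  sumFin≗sum {ℕ.zero}  f = refl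
  sumFin≗sum {ℕ.suc k} f = cong (_+_ (f zero)) (sumFin≗sum (f ∘ suc))

  sum-neg : ∀ {k} (f : Fin k → ℤ) → sum (λ i → - f i) ≡ - sum f
  sum-neg f = begin
    sum (λ i → - f i)       ≡⟨ sum-cong-≗ (λ i → sym (-1*i≡-i (f i))) ⟩
    sum (λ i → - 1ℤ * f i)  ≡⟨ *-distribˡ-sum (- 1ℤ) f ⟨
    - 1ℤ * sum f            ≡⟨ -1*i≡-i (sum f) ⟩
    - sum f                 ∎

  sum-single : ∀ {k} (g : Fin k → ℤ) (i : Fin k) → (∀ j → j ≢ i → g j ≡ 0ℤ) → sum g ≡ g i
  sum-single {ℕ.suc k} g i vanish = begin
    sum g                             ≡⟨ sum-remove {i = i} g ⟩
    g i + ∑[ b < k ] g (punchIn i b)  ≡⟨ cong (_+_ (g i)) (sum-zero others) ⟩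
    g i + 0ℤ                          ≡⟨ +-identityʳ (g i) ⟩
    g i                               ∎
    where
    others : ∀ b → g (punchIn i b) ≡ 0ℤ
    others b = vanish (punchIn i b) (punchInᵢ≢i i b)

  sum-b2z : ∀ {k} (p : Fin k → Bool) → sum (b2z ∘ p) ≡ + countFin p
  sum-b2z {ℕ.zero}  p = refl
  sum-b2z {ℕ.suc k} p with p zero
  ... | true  rewrite sum-b2z (p ∘ suc) = refl
  ... | false rewrite sum-b2z (p ∘ suc) = refl

  self-negating : ∀ {x : ℤ} → x ≡ - x → x ≡ 0ℤ
  self-negating {+ ℕ.zero}  _  = refl
  self-negating {+ ℕ.suc _} ()
  self-negating { -[1+ _ ]} ()

  minor : ∀ {k} → Fin (ℕ.suc k) → Matrix (ℕ.suc k) (ℕ.suc k) → Matrix k k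
  minor j A r c = A (suc r) (punchIn j c)

  det-expand : ∀ {k} (A : Matrix (ℕ.suc k) (ℕ.suc k)) →
               det A ≡ ∑[ j < ℕ.suc k ] (sign (toℕ j) * A zero j * det (minor j A))
  det-expand A = sumFin≗sum (λ j → sign (toℕ j) * A zero j * det (minor j A))

  det-cong : ∀ {k} {A B : Matrix k k} → (∀ r c → A r c ≡ B r c) → det A ≡ det B
  det-cong {ℕ.zero}  A≗B = refl
  det-cong {ℕ.suc k} {A} {B} A≗B = begin
    det A                                                          ≡⟨ det-expand A ⟩
    ∑[ j < ℕ.suc k ] (sign (toℕ j) * A zero j * det (minor j A))   ≡⟨ sum-cong-≗ term ⟩
    ∑[ j < ℕ.suc k ] (sign (toℕ j) * B zero j * det (minor j B))   ≡⟨ det-expand B ⟨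
    det B                                                          ∎
    where
    term : ∀ j → sign (toℕ j) * A zero j * det (minor j A) ≡ sign (toℕ j) * B zero j * det (minor j B)
    term j = cong₂ (λ a d → sign (toℕ j) * a * d) (A≗B zero j)
                   (det-cong (λ r c → A≗B (suc r) (punchIn j c)))

  det-∷-linear : ∀ {k l} (x : Fin (ℕ.suc k) → ℤ) (w : Fin l → ℤ) (y : Fin l → Fin (ℕ.suc k) → ℤ)
                 (R : Matrix k (ℕ.suc k)) →
                 det ((λ c → x c + ∑[ t < l ] (w t * y t c)) ∷ R)
                 ≡ det (x ∷ R) + ∑[ t < l ] (w t * det (y t ∷ R))
  det-∷-linear {k} {l} x w y R = begin
    det ((λ c → x c + ∑[ t < l ] (w t * y t c)) ∷ R)
      ≡⟨ det-expand ((λ c → x c + ∑[ t < l ] (w t * y t c)) ∷ R) ⟩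
    ∑[ j < ℕ.suc k ] (s j * (x j + ∑[ t < l ] (w t * y t j)) * d j)
      ≡⟨ sum-cong-≗ distribute ⟩
    ∑[ j < ℕ.suc k ] (s j * x j * d j + ∑[ t < l ] (w t * (s j * y t j * d j)))
      ≡⟨ ∑-distrib-+ (λ j → s j * x j * d j) (λ j → ∑[ t < l ] (w t * (s j * y t j * d j))) ⟩
    ∑[ j < ℕ.suc k ] (s j * x j * d j) + ∑[ j < ℕ.suc k ] ∑[ t < l ] (w t * (s j * y t j * d j))
      ≡⟨ cong₂ _+_ (sym (det-expand (x ∷ R))) (∑-comm (λ j t → w t * (s j * y t j * d j))) ⟩
    det (x ∷ R) + ∑[ t < l ] ∑[ j < ℕ.suc k ] (w t * (s j * y t j * d j))
      ≡⟨ cong (_+_ (det (x ∷ R))) (sum-cong-≗ factor) ⟩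
    det (x ∷ R) + ∑[ t < l ] (w t * det (y t ∷ R))
      ∎
    where
    s : Fin (ℕ.suc k) → ℤ
    s j = sign (toℕ j)
    d : Fin (ℕ.suc k) → ℤ
    d j = det (minor j (x ∷ R))
    factor : ∀ t → ∑[ j < ℕ.suc k ] (w t * (s j * y t j * d j)) ≡ w t * det (y t ∷ R)
    factor t = trans (sym (*-distribˡ-sum (w t) (λ j → s j * y t j * d j)))
                     (cong (_*_ (w t)) (sym (det-expand (y t ∷ R))))
    distribute : ∀ j → s j * (x j + ∑[ t < l ] (w t * y t j)) * d j
                     ≡ s j * x j * d j + ∑[ t < l ] (w t * (s j * y t j * d j))
    distribute j = begin
      s j * (x j + ∑[ t < l ] (w t * y t j)) * d j
        ≡⟨ ring₁ (s j) (x j) (∑[ t < l ] (w t * y t j)) (d j) ⟩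
      s j * x j * d j + (∑[ t < l ] (w t * y t j)) * (s j * d j)
        ≡⟨ cong (_+_ (s j * x j * d j)) (*-distribʳ-sum (s j * d j) (λ t → w t * y t j)) ⟩
      s j * x j * d j + ∑[ t < l ] (w t * y t j * (s j * d j))
        ≡⟨ cong (_+_ (s j * x j * d j)) (sum-cong-≗ (λ t → ring₂ (w t) (y t j) (s j) (d j))) ⟩
      s j * x j * d j + ∑[ t < l ] (w t * (s j * y t j * d j))
        ∎
      where
      ring₁ : ∀ a b c e → a * (b + c) * e ≡ a * b * e + c * (a * e)
      ring₁ = solve-∀
      ring₂ : ∀ a b c e → a * b * (c * e) ≡ a * (c * b * e)
      ring₂ = solve-∀

  sign-suc : ∀ n → sign (ℕ.suc n) ≡ - sign n
  sign-suc ℕ.zero           = refl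
  sign-suc (ℕ.suc ℕ.zero)    = refl
  sign-suc (ℕ.suc (ℕ.suc n)) = sign-suc n

  sign-punchOut : ∀ {k} {x y : Fin (2 ℕ.+ k)} (x≢y : x ≢ y) (y≢x : y ≢ x) →
                  sign (toℕ x) * sign (toℕ (punchOut x≢y)) ≡ - (sign (toℕ y) * sign (toℕ (punchOut y≢x)))
  sign-punchOut {x = zero} {zero} x≢y _ = contradiction refl x≢y
  sign-punchOut {x = zero} {suc y} _ _ rewrite sign-suc (toℕ y) = ring (sign (toℕ y))
    where
    ring : ∀ a → 1ℤ * a ≡ - (- a * 1ℤ)
    ring = solve-∀
  sign-punchOut {x = suc x} {zero} _ _ rewrite sign-suc (toℕ x) = ring (sign (toℕ x))
    where
    ring : ∀ a → - a * 1ℤ ≡ - (1ℤ * a)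
    ring = solve-∀
  sign-punchOut {ℕ.zero} {suc zero} {suc zero} x≢y _ = contradiction refl x≢y
  sign-punchOut {ℕ.suc k} {suc x} {suc y} x≢y y≢x = begin
    sign (ℕ.suc (toℕ x)) * sign (ℕ.suc (toℕ p))      ≡⟨ sign-suc-* (toℕ x) (toℕ p) ⟩
    sign (toℕ x) * sign (toℕ p)                     ≡⟨ sign-punchOut (x≢y ∘ cong suc) (y≢x ∘ cong suc) ⟩
    - (sign (toℕ y) * sign (toℕ q))                 ≡⟨ cong -_ (sign-suc-* (toℕ y) (toℕ q)) ⟨
    - (sign (ℕ.suc (toℕ y)) * sign (ℕ.suc (toℕ q)))  ∎
    where
    p q : Fin (ℕ.suc k)
    p = punchOut (x≢y ∘ cong suc)
    q = punchOut (y≢x ∘ cong suc)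
    neg-*-neg : ∀ a b → - a * - b ≡ a * b
    neg-*-neg = solve-∀
    sign-suc-* : ∀ i j → sign (ℕ.suc i) * sign (ℕ.suc j) ≡ sign i * sign j
    sign-suc-* i j = trans (cong₂ _*_ (sign-suc i) (sign-suc j)) (neg-*-neg (sign i) (sign j))

  punchIn-punchOut-comm : ∀ {k} {x y : Fin (2 ℕ.+ k)} (x≢y : x ≢ y) (y≢x : y ≢ x) (c : Fin k) →
                          punchIn x (punchIn (punchOut x≢y) c) ≡ punchIn y (punchIn (punchOut y≢x) c)
  punchIn-punchOut-comm {x = zero}  {zero}  x≢y _ _ = contradiction refl x≢y
  punchIn-punchOut-comm {x = zero}  {suc y} _ _ _ = refl
  punchIn-punchOut-comm {x = suc x} {zero}  _ _ _ = refl
  punchIn-punchOut-comm {ℕ.suc k} {suc x} {suc y} _ _ zero = refl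
  punchIn-punchOut-comm {ℕ.suc k} {suc x} {suc y} x≢y y≢x (suc c) =
    cong suc (punchIn-punchOut-comm (x≢y ∘ cong suc) (y≢x ∘ cong suc) c)

  swap₀₁ : ∀ {k c} → Matrix (2 ℕ.+ k) c → Matrix (2 ℕ.+ k) c
  swap₀₁ A = A (suc zero) ∷ A zero ∷ tail (tail A)

  -- The summand of the Laplace expansion along the first two rows in which row 0 uses
  -- column x and row 1 uses column y.
  pairTerm : ∀ {k} → Matrix (2 ℕ.+ k) (2 ℕ.+ k) → Fin (2 ℕ.+ k) → Fin (2 ℕ.+ k) → ℤ
  pairTerm A x y with x ≟ y
  ... | yes _   = 0ℤ
  ... | no x≢y = sign (toℕ x) * sign (toℕ (punchOut x≢y)) * (A zero x * A (suc zero) y)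
                 * det (minor (punchOut x≢y) (minor x A))

  pairTerm-diagonal : ∀ {k} (A : Matrix (2 ℕ.+ k) (2 ℕ.+ k)) x → pairTerm A x x ≡ 0ℤ
  pairTerm-diagonal A x with x ≟ x
  ... | yes _   = refl
  ... | no x≢x = contradiction refl x≢x

  pairTerm-punchIn : ∀ {k} (A : Matrix (2 ℕ.+ k) (2 ℕ.+ k)) a b →
                     pairTerm A a (punchIn a b)
                     ≡ sign (toℕ a) * sign (toℕ b) * (A zero a * A (suc zero) (punchIn a b))
                       * det (minor b (minor a A))
  pairTerm-punchIn A a b with a ≟ punchIn a b
  ... | yes a≡ = contradiction (sym a≡) (punchInᵢ≢i a b)
  ... | no a≢ = cong (λ p → sign (toℕ a) * sign (toℕ p) * (A zero a * A (suc zero) (punchIn a b))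
                            * det (minor p (minor a A)))
                     (trans (punchOut-cong a refl) (punchOut-punchIn a))

  det-pairSum : ∀ {k} (A : Matrix (2 ℕ.+ k) (2 ℕ.+ k)) →
                det A ≡ ∑[ x < 2 ℕ.+ k ] ∑[ y < 2 ℕ.+ k ] pairTerm A x y
  det-pairSum {k} A = begin
    det A                                                          ≡⟨ det-expand A ⟩
    ∑[ a < 2 ℕ.+ k ] (sign (toℕ a) * A zero a * det (minor a A))   ≡⟨ sum-cong-≗ expand-minor ⟩
    ∑[ a < 2 ℕ.+ k ] ∑[ b < 1 ℕ.+ k ] pairTerm A a (punchIn a b)   ≡⟨ sum-cong-≗ omit-diagonal ⟨
    ∑[ x < 2 ℕ.+ k ] ∑[ y < 2 ℕ.+ k ] pairTerm A x y               ∎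
    where
    ring : ∀ a b c e f → a * b * (c * e * f) ≡ a * c * (b * e) * f
    ring = solve-∀
    expand-minor : ∀ a → sign (toℕ a) * A zero a * det (minor a A) ≡ ∑[ b < 1 ℕ.+ k ] pairTerm A a (punchIn a b)
    expand-minor a = begin
      sa * det (minor a A)                  ≡⟨ cong (_*_ sa) (det-expand (minor a A)) ⟩
      sa * ∑[ b < 1 ℕ.+ k ] (cofactor b)    ≡⟨ *-distribˡ-sum sa cofactor ⟩
      ∑[ b < 1 ℕ.+ k ] (sa * cofactor b)    ≡⟨ sum-cong-≗ regroup ⟩
      ∑[ b < 1 ℕ.+ k ] pairTerm A a (punchIn a b) ∎
      where
      sa : ℤ
      sa = sign (toℕ a) * A zero a
      cofactor : Fin (1 ℕ.+ k) → ℤ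
      cofactor b = sign (toℕ b) * A (suc zero) (punchIn a b) * det (minor b (minor a A))
      regroup : ∀ b → sa * cofactor b ≡ pairTerm A a (punchIn a b)
      regroup b = trans (ring (sign (toℕ a)) (A zero a) (sign (toℕ b)) (A (suc zero) (punchIn a b))
                              (det (minor b (minor a A))))
                        (sym (pairTerm-punchIn A a b))
    omit-diagonal : ∀ a → ∑[ y < 2 ℕ.+ k ] pairTerm A a y ≡ ∑[ b < 1 ℕ.+ k ] pairTerm A a (punchIn a b)
    omit-diagonal a = trans (sum-remove {i = a} (pairTerm A a))
                            (trans (cong (_+ rest) (pairTerm-diagonal A a)) (+-identityˡ rest))
      where
      rest : ℤ
      rest = ∑[ b < 1 ℕ.+ k ] pairTerm A a (punchIn a b)

  pairTerm-swap₀₁ : ∀ {k} (A : Matrix (2 ℕ.+ k) (2 ℕ.+ k)) x y → pairTerm (swap₀₁ A) x y ≡ - pairTerm A y x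
  pairTerm-swap₀₁ A x y with x ≟ y | y ≟ x
  ... | yes _   | yes _   = refl
  ... | yes x≡y | no y≢x = contradiction (sym x≡y) y≢x
  ... | no x≢y | yes y≡x = contradiction (sym y≡x) x≢y
  ... | no x≢y | no y≢x = begin
    sx * (A (suc zero) x * A zero y) * dx     ≡⟨ cong₂ (λ s d → s * (A (suc zero) x * A zero y) * d)
                                                       (sign-punchOut x≢y y≢x) (det-cong same-minor) ⟩
    - sy * (A (suc zero) x * A zero y) * dy   ≡⟨ ring sy (A (suc zero) x) (A zero y) dy ⟩
    - (sy * (A zero y * A (suc zero) x) * dy) ∎
    where
    sx sy dx dy : ℤ
    sx = sign (toℕ x) * sign (toℕ (punchOut x≢y))
    sy = sign (toℕ y) * sign (toℕ (punchOut y≢x))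
    dx = det (minor (punchOut x≢y) (minor x A))
    dy = det (minor (punchOut y≢x) (minor y A))
    ring : ∀ s a b d → - s * (a * b) * d ≡ - (s * (b * a) * d)
    ring = solve-∀
    same-minor : ∀ r c → minor (punchOut x≢y) (minor x A) r c ≡ minor (punchOut y≢x) (minor y A) r c
    same-minor r c = cong (A (suc (suc r))) (punchIn-punchOut-comm x≢y y≢x c)

  det-swap₀₁ : ∀ {k} (A : Matrix (2 ℕ.+ k) (2 ℕ.+ k)) → det (swap₀₁ A) ≡ - det A
  det-swap₀₁ {k} A = begin
    det (swap₀₁ A)                                ≡⟨ det-pairSum (swap₀₁ A) ⟩
    ∑[ x < n ] ∑[ y < n ] pairTerm (swap₀₁ A) x y ≡⟨ sum-cong-≗ (sum-cong-≗ ∘ pairTerm-swap₀₁ A) ⟩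
    ∑[ x < n ] ∑[ y < n ] (- pairTerm A y x)      ≡⟨ sum-cong-≗ (λ x → sum-neg (λ y → pairTerm A y x)) ⟩
    ∑[ x < n ] (- ∑[ y < n ] pairTerm A y x)      ≡⟨ sum-neg (λ x → ∑[ y < n ] pairTerm A y x) ⟩
    - ∑[ x < n ] ∑[ y < n ] pairTerm A y x        ≡⟨ cong -_ (∑-comm (λ x y → pairTerm A y x)) ⟩
    - ∑[ y < n ] ∑[ x < n ] pairTerm A y x        ≡⟨ cong -_ (det-pairSum A) ⟨
    - det A                                       ∎
    where
    n : ℕ
    n = 2 ℕ.+ k

  det-repeated-head : ∀ {k} (A : Matrix (ℕ.suc k) (ℕ.suc k)) (j : Fin k) → A zero ≗ A (suc j) → det A ≡ 0ℤ
  det-repeated-head A zero head≗ = self-negating (begin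
    det A          ≡⟨ det-cong swap-fixes ⟨
    det (swap₀₁ A) ≡⟨ det-swap₀₁ A ⟩
    - det A        ∎)
    where
    swap-fixes : ∀ r c → swap₀₁ A r c ≡ A r c
    swap-fixes zero          c = sym (head≗ c)
    swap-fixes (suc zero)    c = head≗ c
    swap-fixes (suc (suc r)) c = refl
  det-repeated-head {ℕ.suc k} A (suc j) head≗ = begin
    det A                ≡⟨ neg-involutive (det A) ⟨
    - - det A            ≡⟨ cong -_ (det-swap₀₁ A) ⟨
    - det (swap₀₁ A)     ≡⟨ cong -_ (trans (det-expand (swap₀₁ A)) (sum-zero term-vanishes)) ⟩
    - 0ℤ                 ∎
    where
    -- After the swap, the repeated row is the first row of every minor.
    term-vanishes : ∀ a → sign (toℕ a) * swap₀₁ A zero a * det (minor a (swap₀₁ A)) ≡ 0ℤ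
    term-vanishes a = trans (cong (_*_ (sign (toℕ a) * swap₀₁ A zero a))
                                  (det-repeated-head (minor a (swap₀₁ A)) j (head≗ ∘ punchIn a)))
                            (*-zeroʳ (sign (toℕ a) * swap₀₁ A zero a))

  StrictlyUpperTriangular : ∀ {k} → Matrix k k → Set
  StrictlyUpperTriangular W = ∀ r c → c Fin.≤ r → W r c ≡ 0ℤ

  LowerTriangular : ∀ {k} → Matrix k k → Set
  LowerTriangular L = ∀ r c → r Fin.< c → L r c ≡ 0ℤ

  rowAdd : ∀ {k} → Matrix k k → Matrix k k → Matrix k k
  rowAdd {k} W A r c = A r c + ∑[ t < k ] (W r t * A t c)

  det-rowAdd : ∀ {k} (W A : Matrix k k) → StrictlyUpperTriangular W → det (rowAdd W A) ≡ det A
  det-rowAdd {ℕ.zero}  W A _     = refl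
  det-rowAdd {ℕ.suc k} W A upper = begin
    det (rowAdd W A)
      ≡⟨ det-expand (rowAdd W A) ⟩
    ∑[ j < ℕ.suc k ] (sign (toℕ j) * rowAdd W A zero j * det (minor j (rowAdd W A)))
      ≡⟨ sum-cong-≗ (λ j → cong (_*_ (sign (toℕ j) * rowAdd W A zero j)) (minor-rowAdd j)) ⟩
    ∑[ j < ℕ.suc k ] (sign (toℕ j) * rowAdd W A zero j * det (minor j A))
      ≡⟨ det-expand (rowAdd W A zero ∷ tail A) ⟨
    det (rowAdd W A zero ∷ tail A)
      ≡⟨ det-∷-linear (A zero) (W zero) A (tail A) ⟩
    det (A zero ∷ tail A) + ∑[ t < ℕ.suc k ] (W zero t * det (A t ∷ tail A))
      ≡⟨ cong₂ _+_ (det-cong head∷tail) (sum-zero added-rows-vanish) ⟩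
    det A + 0ℤ
      ≡⟨ +-identityʳ (det A) ⟩
    det A
      ∎
    where
    W₊ : Matrix k k
    W₊ r t = W (suc r) (suc t)
    minor-rowAdd : ∀ j → det (minor j (rowAdd W A)) ≡ det (minor j A)
    minor-rowAdd j = trans (det-cong entry)
                           (det-rowAdd W₊ (minor j A) (λ r t t≤r → upper (suc r) (suc t) (ℕ.s≤s t≤r)))
      where
      rest : Fin k → Fin k → ℤ
      rest r c = ∑[ t < k ] (W₊ r t * minor j A t c)
      entry : ∀ r c → minor j (rowAdd W A) r c ≡ rowAdd W₊ (minor j A) r c
      entry r c = cong (_+_ (minor j A r c))
                       (trans (cong (λ w → w * A zero (punchIn j c) + rest r c) (upper (suc r) zero ℕ.z≤n))
                              (+-identityˡ (rest r c)))
    head∷tail : ∀ r c → (A zero ∷ tail A) r c ≡ A r c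
    head∷tail zero    c = refl
    head∷tail (suc r) c = refl
    added-rows-vanish : ∀ t → W zero t * det (A t ∷ tail A) ≡ 0ℤ
    added-rows-vanish zero    = cong (_* det (A zero ∷ tail A)) (upper zero zero ℕ.z≤n)
    added-rows-vanish (suc i) =
      trans (cong (_*_ (W zero (suc i))) (det-repeated-head (A (suc i) ∷ tail A) i (λ _ → refl)))
            (*-zeroʳ (W zero (suc i)))

  det-lowerTriangular : ∀ {k} (L : Matrix k k) → LowerTriangular L → det L ≡ product (λ i → L i i)
  det-lowerTriangular {ℕ.zero}  L _     = refl
  det-lowerTriangular {ℕ.suc k} L lower = begin
    det L
      ≡⟨ det-expand L ⟩
    1ℤ * L zero zero * det (minor zero L) + ∑[ j < k ] off-diagonal j
      ≡⟨ cong₂ _+_ (cong₂ _*_ (*-identityˡ (L zero zero)) diagonal-minor) (sum-zero off-diagonal-vanishes) ⟩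
    L zero zero * product (λ i → L (suc i) (suc i)) + 0ℤ
      ≡⟨ +-identityʳ (product (λ i → L i i)) ⟩
    product (λ i → L i i)
      ∎
    where
    diagonal-minor : det (minor zero L) ≡ product (λ i → L (suc i) (suc i))
    diagonal-minor = det-lowerTriangular (minor zero L) (λ r c r<c → lower (suc r) (suc c) (ℕ.s≤s r<c))
    off-diagonal : Fin k → ℤ
    off-diagonal j = sign (toℕ (suc j)) * L zero (suc j) * det (minor (suc j) L)
    off-diagonal-vanishes : ∀ j → off-diagonal j ≡ 0ℤ
    off-diagonal-vanishes j rewrite lower zero (suc j) (ℕ.s≤s ℕ.z≤n) | *-zeroʳ (sign (toℕ (suc j))) = refl

module Reduction {n m} (G : Graph n m) (D : Fin n → Bool) where

  open import Data.Integer using (_+_; _-_)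
  open import Data.Integer.Properties using (+-identityˡ; +-identityʳ; +-inverseʳ; *-identityʳ; *-zeroʳ)
  open import Algebra.Properties.Semiring.Sum +-*-semiring using (sum; sum-syntax; sum-cong-≗)
  open MonoidSums +-0-monoid using (sum-enumerate; sum-↑) renaming (sum-ε to sum-zero)
  open Determinant
  open ≡-Reasoning

  data Element : Fin (n ℕ.+ m) → Set where
    vertex : ∀ v → Element (v ↑ˡ m)
    edge   : ∀ e → Element (n ↑ʳ e)

  element : ∀ x → Element x
  element x = subst Element (join-splitAt n m x) (fromSplit (splitAt n x))
    where
    fromSplit : (s : Fin n ⊎ Fin m) → Element (join n m s)
    fromSplit (inj₁ v) = vertex v
    fromSplit (inj₂ e) = edge e

  vertex<edge : ∀ (v : Fin n) (e : Fin m) → v ↑ˡ m Fin.< n ↑ʳ e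
  vertex<edge v e = subst₂ ℕ._<_ (sym (toℕ-↑ˡ v m)) (sym (toℕ-↑ʳ n e))
                           (ℕ.<-≤-trans (toℕ<n v) (ℕ.m≤m+n n (toℕ e)))

  M : Matrix (n ℕ.+ m) (n ℕ.+ m)
  M = incMatrix G

  incidence : Fin n → Fin m → ℤ
  incidence v e = b2z (incidentB G v e)

  M-vertex-vertex : ∀ u v → M (u ↑ˡ m) (v ↑ˡ m) ≡ b2z ⌊ u ≟ v ⌋
  M-vertex-vertex u v rewrite splitAt-↑ˡ n u m | splitAt-↑ˡ n v m = refl

  M-vertex-edge : ∀ v e → M (v ↑ˡ m) (n ↑ʳ e) ≡ incidence v e
  M-vertex-edge v e rewrite splitAt-↑ˡ n v m | splitAt-↑ʳ n m e = refl

  M-edge-vertex : ∀ e v → M (n ↑ʳ e) (v ↑ˡ m) ≡ incidence v e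
  M-edge-vertex e v rewrite splitAt-↑ʳ n m e | splitAt-↑ˡ n v m = refl

  M-edge-edge : ∀ e f → M (n ↑ʳ e) (n ↑ʳ f) ≡ b2z ⌊ e ≟ f ⌋
  M-edge-edge e f rewrite splitAt-↑ʳ n m e | splitAt-↑ʳ n m f = refl

  selected : Fin (n ℕ.+ m) → Bool
  selected = [ D , crossingB G D ]′ ∘ splitAt n

  selected-vertex : ∀ v → selected (v ↑ˡ m) ≡ D v
  selected-vertex v rewrite splitAt-↑ˡ n v m = refl

  selected-edge : ∀ e → selected (n ↑ʳ e) ≡ crossingB G D e
  selected-edge e rewrite splitAt-↑ʳ n m e = refl

  weight : Fin (n ℕ.+ m) → Fin (n ℕ.+ m) → ℤ
  weight x y with splitAt n x | splitAt n y
  ... | inj₁ v | inj₂ e = - incidence v e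
  ... | _      | _      = 0ℤ

  weight-vertex-edge : ∀ v e → weight (v ↑ˡ m) (n ↑ʳ e) ≡ - incidence v e
  weight-vertex-edge v e rewrite splitAt-↑ˡ n v m | splitAt-↑ʳ n m e = refl

  weight-to-vertex : ∀ x u → weight x (u ↑ˡ m) ≡ 0ℤ
  weight-to-vertex x u with element x
  ... | vertex v rewrite splitAt-↑ˡ n v m | splitAt-↑ˡ n u m = refl
  ... | edge e   rewrite splitAt-↑ʳ n m e = refl

  weight-from-edge : ∀ e y → weight (n ↑ʳ e) y ≡ 0ℤ
  weight-from-edge e y rewrite splitAt-↑ʳ n m e = refl

  weight-strictlyUpper : ∀ x y → y Fin.≤ x → weight x y ≡ 0ℤ
  weight-strictlyUpper x y y≤x with element x | element y
  ... | vertex v | vertex u = weight-to-vertex (v ↑ˡ m) u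
  ... | edge e   | _        = weight-from-edge e y
  ... | vertex v | edge e   = contradiction y≤x (ℕ.<⇒≱ (vertex<edge v e))

  reduced : Fin (n ℕ.+ m) → Fin (n ℕ.+ m) → ℤ
  reduced x y = M x y + ∑[ z < n ℕ.+ m ] (if selected z then weight x z * M z y else 0ℤ)

  correction : Fin n → Fin (n ℕ.+ m) → Fin m → ℤ
  correction v y e = if crossingB G D e then - incidence v e * M (n ↑ʳ e) y else 0ℤ

  reduced-edge : ∀ e y → reduced (n ↑ʳ e) y ≡ M (n ↑ʳ e) y
  reduced-edge e y = trans (cong (_+_ (M (n ↑ʳ e) y)) (sum-zero vanish)) (+-identityʳ (M (n ↑ʳ e) y))
    where
    vanish : ∀ z → (if selected z then weight (n ↑ʳ e) z * M z y else 0ℤ) ≡ 0ℤ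
    vanish z = if-zero (selected z) (cong (_* M z y) (weight-from-edge e z))

  reduced-vertex : ∀ v y → reduced (v ↑ˡ m) y ≡ M (v ↑ˡ m) y + sum (correction v y)
  reduced-vertex v y = cong (_+_ (M (v ↑ˡ m) y)) (begin
    sum term                                    ≡⟨ sum-↑ n term ⟩
    sum (term ∘ (_↑ˡ m)) + sum (term ∘ (n ↑ʳ_)) ≡⟨ cong₂ _+_ (sum-zero to-vertices) (sum-cong-≗ to-edges) ⟩
    0ℤ + sum (correction v y)                   ≡⟨ +-identityˡ (sum (correction v y)) ⟩
    sum (correction v y)                        ∎)
    where
    term : Fin (n ℕ.+ m) → ℤ
    term z = if selected z then weight (v ↑ˡ m) z * M z y else 0ℤ
    to-vertices : ∀ u → term (u ↑ˡ m) ≡ 0ℤ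
    to-vertices u = if-zero (selected (u ↑ˡ m)) (cong (_* M (u ↑ˡ m) y) (weight-to-vertex (v ↑ˡ m) u))
    to-edges : ∀ e → term (n ↑ʳ e) ≡ correction v y e
    to-edges e rewrite selected-edge e | weight-vertex-edge v e = refl

  incident-endpoint : ∀ {v e} → incidentB G v e ≡ true → proj₁ (ends G e) ≡ v ⊎ proj₂ (ends G e) ≡ v
  incident-endpoint {v} {e} incident with proj₁ (ends G e) ≟ v | proj₂ (ends G e) ≟ v
  ... | yes end₁≡v | _         = inj₁ end₁≡v
  ... | no _       | yes end₂≡v = inj₂ end₂≡v
  ... | no _       | no _       with () ← incident

  not-crossing-within-D : ∀ {v w e} → D v ≡ true → D w ≡ true → v ≢ w →
                          incidentB G v e ≡ true → incidentB G w e ≡ true → crossingB G D e ≡ false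
  not-crossing-within-D {v} {w} {e} Dv Dw v≢w v∈e w∈e with incident-endpoint v∈e | incident-endpoint w∈e
  ... | inj₁ refl | inj₁ refl = contradiction refl v≢w
  ... | inj₂ refl | inj₂ refl = contradiction refl v≢w
  ... | inj₁ refl | inj₂ refl rewrite Dv | Dw = refl
  ... | inj₂ refl | inj₁ refl rewrite Dv | Dw = refl

  reduced-vertex-diagonal : ∀ v → reduced (v ↑ˡ m) (v ↑ˡ m) ≡ 1ℤ - + degH G D v
  reduced-vertex-diagonal v = begin
    reduced (v ↑ˡ m) (v ↑ˡ m)                        ≡⟨ reduced-vertex v (v ↑ˡ m) ⟩
    M (v ↑ˡ m) (v ↑ˡ m) + sum (correction v (v ↑ˡ m)) ≡⟨ cong₂ _+_ (trans (M-vertex-vertex v v) (b2z-≟-refl v))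
                                                                  (sum-cong-≗ H-edge) ⟩
    1ℤ + ∑[ e < m ] (- b2z (inH e))                  ≡⟨ cong (_+_ 1ℤ) (sum-neg (b2z ∘ inH)) ⟩
    1ℤ - sum (b2z ∘ inH)                             ≡⟨ cong (_-_ 1ℤ) (sum-b2z inH) ⟩
    1ℤ - + degH G D v                                ∎
    where
    inH : Fin m → Bool
    inH e = incidentB G v e ∧ crossingB G D e
    H-edge : ∀ e → correction v (v ↑ˡ m) e ≡ - b2z (inH e)
    H-edge e rewrite M-edge-vertex e v with crossingB G D e | incidentB G v e
    ... | true  | true  = refl
    ... | true  | false = refl
    ... | false | true  = refl
    ... | false | false = refl

  reduced-vertex-vertex : ∀ {v w} → D v ≡ true → D w ≡ true → v ≢ w →
                          reduced (v ↑ˡ m) (w ↑ˡ m) ≡ 0ℤ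
  reduced-vertex-vertex {v} {w} Dv Dw v≢w = begin
    reduced (v ↑ˡ m) (w ↑ˡ m)                        ≡⟨ reduced-vertex v (w ↑ˡ m) ⟩
    M (v ↑ˡ m) (w ↑ˡ m) + sum (correction v (w ↑ˡ m)) ≡⟨ cong₂ _+_ (trans (M-vertex-vertex v w) (b2z-≟-≢ v≢w))
                                                                  (sum-zero no-common-H-edge) ⟩
    0ℤ                                               ∎
    where
    no-common-H-edge : ∀ e → correction v (w ↑ˡ m) e ≡ 0ℤ
    no-common-H-edge e rewrite M-edge-vertex e w
      with crossingB G D e in crossing | incidentB G v e in v∈e | incidentB G w e in w∈e
    ... | false | _     | _     = refl
    ... | true  | false | _     = refl
    ... | true  | true  | false = refl
    ... | true  | true  | true  with () ← trans (sym crossing) (not-crossing-within-D Dv Dw v≢w v∈e w∈e)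

  reduced-vertex-edge : ∀ v {f} → crossingB G D f ≡ true → reduced (v ↑ˡ m) (n ↑ʳ f) ≡ 0ℤ
  reduced-vertex-edge v {f} f∈H = begin
    reduced (v ↑ˡ m) (n ↑ʳ f)                        ≡⟨ reduced-vertex v (n ↑ʳ f) ⟩
    M (v ↑ˡ m) (n ↑ʳ f) + sum (correction v (n ↑ʳ f)) ≡⟨ cong₂ _+_ (M-vertex-edge v f)
                                                                  (sum-single (correction v (n ↑ʳ f)) f other-edges) ⟩
    incidence v f + correction v (n ↑ʳ f) f          ≡⟨ cong (_+_ (incidence v f)) diagonal ⟩
    incidence v f - incidence v f                    ≡⟨ +-inverseʳ (incidence v f) ⟩
    0ℤ                                               ∎
    where
    other-edges : ∀ e → e ≢ f → correction v (n ↑ʳ f) e ≡ 0ℤ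
    other-edges e e≢f rewrite M-edge-edge e f | b2z-≟-≢ e≢f =
      if-zero (crossingB G D e) (*-zeroʳ (- incidence v e))
    diagonal : correction v (n ↑ʳ f) f ≡ - incidence v f
    diagonal rewrite f∈H | M-edge-edge f f | b2z-≟-refl f = *-identityʳ (- incidence v f)

  reduced-lowerTriangular : ∀ x y → selected x ≡ true → selected y ≡ true → x Fin.< y → reduced x y ≡ 0ℤ
  reduced-lowerTriangular x y x∈S y∈S x<y with element x | element y
  ... | vertex v | vertex w = reduced-vertex-vertex (trans (sym (selected-vertex v)) x∈S)
                                                    (trans (sym (selected-vertex w)) y∈S)
                                                    (λ v≡w → <-irrefl (cong (_↑ˡ m) v≡w) x<y)
  ... | vertex v | edge f   = reduced-vertex-edge v (trans (sym (selected-edge f)) y∈S)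
  ... | edge e   | vertex w = contradiction (vertex<edge w e) (ℕ.<-asym x<y)
  ... | edge e   | edge f   = trans (reduced-edge e (n ↑ʳ f))
                                (trans (M-edge-edge e f) (b2z-≟-≢ (λ e≡f → <-irrefl (cong (n ↑ʳ_) e≡f) x<y)))

  product-pivots : product (λ x → if selected x then reduced x x else 1ℤ)
                   ≡ product (λ v → if D v then 1ℤ - + degH G D v else 1ℤ)
  product-pivots = begin
    product pivot
      ≡⟨ product-↑ n pivot ⟩
    product (pivot ∘ (_↑ˡ m)) * product (pivot ∘ (n ↑ʳ_))
      ≡⟨ cong₂ _*_ (product-cong-≗ vertex-pivot) (product-one edge-pivot) ⟩
    product (λ v → if D v then 1ℤ - + degH G D v else 1ℤ) * 1ℤ
      ≡⟨ *-identityʳ _ ⟩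
    product (λ v → if D v then 1ℤ - + degH G D v else 1ℤ)
      ∎
    where
    pivot : Fin (n ℕ.+ m) → ℤ
    pivot x = if selected x then reduced x x else 1ℤ
    vertex-pivot : ∀ v → pivot (v ↑ˡ m) ≡ (if D v then 1ℤ - + degH G D v else 1ℤ)
    vertex-pivot v rewrite selected-vertex v | reduced-vertex-diagonal v = refl
    edge-pivot : ∀ e → pivot (n ↑ʳ e) ≡ 1ℤ
    edge-pivot e rewrite selected-edge e | reduced-edge e (n ↑ʳ e) | M-edge-edge e e | b2z-≟-refl e =
      if-eta (crossingB G D e)

  K : ℕ
  K = countFin selected

  S : Fin K → Fin (n ℕ.+ m)
  S = enumerate selected

  det-selected : det (submatrix M S S) ≡ product (λ v → if D v then 1ℤ - + degH G D v else 1ℤ)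
  det-selected = begin
    det A                                  ≡⟨ det-rowAdd W A W-upper ⟨
    det (rowAdd W A)                       ≡⟨ det-cong rowAdd≗reduced ⟩
    det (λ r c → reduced (S r) (S c))      ≡⟨ det-lowerTriangular (λ r c → reduced (S r) (S c)) lower ⟩
    product (λ r → reduced (S r) (S r))    ≡⟨ product-enumerate selected (λ x → reduced x x) ⟩
    product (λ x → if selected x then reduced x x else 1ℤ) ≡⟨ product-pivots ⟩
    product (λ v → if D v then 1ℤ - + degH G D v else 1ℤ) ∎
    where
    A W : Matrix K K
    A = submatrix M S S
    W r t = weight (S r) (S t)
    W-upper : StrictlyUpperTriangular W
    W-upper r t t≤r =
      weight-strictlyUpper (S r) (S t) (strictlyIncreasing⇒monotone (enumerate-strictlyIncreasing selected) t≤r)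
    rowAdd≗reduced : ∀ r c → rowAdd W A r c ≡ reduced (S r) (S c)
    rowAdd≗reduced r c = cong (_+_ (M (S r) (S c))) (sum-enumerate selected (λ z → weight (S r) z * M z (S c)))
    lower : LowerTriangular (λ r c → reduced (S r) (S c))
    lower r c r<c = reduced-lowerTriangular (S r) (S c) (enumerate-selected selected r) (enumerate-selected selected c)
                      (enumerate-strictlyIncreasing selected r c r<c)

prodD-≤-∣product∣ : ∀ {k} (D : Fin k → Bool) (f : Fin k → ℕ) (g : Fin k → ℤ) →
                    (∀ v → f v ≤ ∣ g v ∣) → prodD D f ≤ ∣ product (λ v → if D v then g v else 1ℤ) ∣
prodD-≤-∣product∣ {ℕ.zero}  D f g f≤g = ℕ.≤-refl
prodD-≤-∣product∣ {ℕ.suc k} D f g f≤g =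
  subst (prodD D f ≤_) (sym (abs-* (if D zero then g zero else 1ℤ) rest))
        (ℕ.*-mono-≤ head (prodD-≤-∣product∣ (D ∘ suc) (f ∘ suc) (g ∘ suc) (f≤g ∘ suc)))
  where
  rest : ℤ
  rest = product (λ v → if D (suc v) then g (suc v) else 1ℤ)
  head : (if D zero then f zero else 1) ≤ ∣ if D zero then g zero else 1ℤ ∣
  head with D zero
  ... | true  = f≤g zero
  ... | false = ℕ.≤-refl

pred≤∣1-∣ : ∀ d → d ∸ 1 ≤ ∣ 1ℤ - + d ∣
pred≤∣1-∣ ℕ.zero            = ℕ.z≤n
pred≤∣1-∣ (ℕ.suc ℕ.zero)    = ℕ.z≤n
pred≤∣1-∣ (ℕ.suc (ℕ.suc d)) = ℕ.≤-refl

-- Opened only here: above, _+_ is integer addition.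
open import Data.Nat using (_+_)

lemma8 : ∀ {n m} (G : Graph n m) (D : Fin n → Bool) →
         (∀ v → D v ≡ true →
            ∃ λ u₁ → ∃ λ u₂ → u₁ ≢ u₂ × D u₁ ≡ false × D u₂ ≡ false
                              × Adj G v u₁ × Adj G v u₂) →
         ∃ λ k → Σ (Fin k → Fin (n + m)) λ rs → Σ (Fin k → Fin (n + m)) λ cs →
           StrictlyIncreasing rs × StrictlyIncreasing cs ×
           prodD D (λ v → degH G D v ∸ 1) ≤ ∣ det (submatrix (incMatrix G) rs cs) ∣
lemma8 G D _ = K , S , S , enumerate-strictlyIncreasing selected , enumerate-strictlyIncreasing selected ,
  subst (λ d → prodD D (λ v → degH G D v ∸ 1) ≤ ∣ d ∣) (sym det-selected)
        (prodD-≤-∣product∣ D (λ v → degH G D v ∸ 1) (λ v → 1ℤ - + degH G D v) (pred≤∣1-∣ ∘ degH G D))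
  where
  open Reduction G D
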